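{- Let $u$ be a positive integer (regarded as a one-letter word). Then a finite word $w$ over the positive integers satisfies $uw\equiv wu$ if and only if the tableau $P=P(w)$, with rows $R_1,R_2,\ldots$ (rows beyond the last nonempty one taken to be empty), satisfies (a) every entry of $R_1$ is at most $u$, and (b) for every $i\ge1$, $\#R_i(<u)=\#R_{i+1}(\le u)$.
   Context: $P(v)$ is the RSK insertion tableau of the word $v$ (row $R_1$ on top). $\equiv$ is Knuth equivalence: $v\equiv w$ iff $P(v)=P(w)$. For a row $R$ and a condition $I$ on integers, $R(I)$ is the multiset of entries of $R$ satisfying $I$; e.g. $\#R(<u)$ is the number of entries of $R$ that are less than $u$ and $\#R(\le u)$ the number that are at most $u$. -}

module Defs where

open import Data.Nat using (ℕ; zero; suc; _<?_; _≤?_)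
open import Data.List using (List; []; _∷_; filter; foldl; [_])
open import Data.Maybe using (Maybe; just; nothing)
open import Data.Product using (_×_; _,_)
open import Relation.Nullary using (yes; no)

-- A word is a list of letters (positivity is imposed in the statement).
Word : Set
Word = List ℕ

Row : Set
Row = List ℕ

-- A tableau is the list of its rows, top row R₁ first.
Tableau : Set
Tableau = List Row

rowInsert : ℕ → Row → Row × Maybe ℕ
rowInsert x [] = (x ∷ [] , nothing)
rowInsert x (y ∷ ys) with x <? y
... | yes _ = (x ∷ ys , just y)
... | no _ with rowInsert x ys
...   | (ys' , b) = (y ∷ ys' , b)

insert : ℕ → Tableau → Tableau
insert x [] = [ x ∷ [] ]
insert x (r ∷ rs) with rowInsert x r
... | (r' , nothing) = r' ∷ rs
... | (r' , just y) = r' ∷ insert y rs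

P : Word → Tableau
P w = foldl (λ t x → insert x t) [] w

-- Knuth equivalence, via the characterization in the context: v ≡ w iff P(v) = P(w).
open import Relation.Binary.PropositionalEquality using (_≡_)
_≡K_ : Word → Word → Set
v ≡K w = P v ≡ P w

-- R_i for i ≥ 1 (rows beyond the last nonempty one are empty).
-- rowAt T i = R_{i+1}, i.e. 0-indexed.
rowAt : Tableau → ℕ → Row
rowAt [] _ = []
rowAt (r ∷ rs) zero = r
rowAt (r ∷ rs) (suc i) = rowAt rs i

open import Data.List using (length)
#< : Row → ℕ → ℕ
#< R u = length (filter (_<? u) R)

#≤ : Row → ℕ → ℕ
#≤ R u = length (filter (_≤? u) R)

{-# OPTIONS --safe #-}
-- Let m be the number of u's in w and R₁ the first row of P(w).
--
-- P(uw) is obtained by row-inserting w into the row [u] and P(wu) by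
-- row-inserting w into the empty row and then u.  Run both insertions side by
-- side.  While the extra u merely rides along, the two first rows differ by
-- that u, the bumped letters agree, and the number of entries ≤ u grows
-- exactly by the number of u's read.  The first time they part, the plain row
-- gains an entry ≤ u that is not a u, and from then on the other row only
-- ever carries an extra entry > u.  Hence P(uw) = P(wu) iff the runs never
-- part and u bumps nothing at the end, i.e. iff m = |R₁|.
--
-- In a semistandard tableau column strictness reads #R_{i+1}(≤ k) ≤ #R_i(< k),
-- and since #R(≤ u) = #R(< u) + #R(= u) the m copies of u telescope:
-- m = #R₁(≤ u) - Σᵢ (#R_i(< u) - #R_{i+1}(≤ u)) ≤ |R₁|.  Equality holds iff
-- R₁ ≤ u and every term of the sum vanishes, which is (a) and (b).
module Submission where

open import Defs
open import Data.Nat using (ℕ; zero; suc; _+_; _≤_; _<_; _≰_; _≤?_; _<?_; _≟_; z≤n; s≤s)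
open import Data.Nat.Properties
open import Data.List using (List; []; _∷_; [_]; _++_; length; filter; foldl; concat; fromMaybe)
open import Data.List.Properties
  using ( foldl-++; filter-accept; filter-reject; filter-++; filter-all; filter-complete
        ; length-filter; length-++; ∷-injectiveˡ; ++-identityʳ)
open import Data.List.Relation.Unary.All as All using (All; []; _∷_) renaming (map to All-map)
open import Data.List.Relation.Unary.All.Properties using (all-filter)
open import Data.List.Relation.Unary.AllPairs using (AllPairs; []; _∷_)
open import Data.List.Relation.Unary.Any using (here; there)
open import Data.List.Membership.Propositional using (_∈_)
open import Data.List.Relation.Binary.Permutation.Propositional
  using (_↭_; ↭-refl; ↭-sym; ↭-prep; ↭-swap; ↭-reflexive; module PermutationReasoning)
open import Data.List.Relation.Binary.Permutation.Propositional.Properties using (↭-length; filter-↭; shift; ++⁺ˡ; ++⁺ʳ)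
open import Data.List.Sort.InsertionSort.Base ≤-decTotalOrder using () renaming (insert to insertSorted)
open import Data.List.Sort.InsertionSort.Properties ≤-decTotalOrder using () renaming (insert-↭ to insertSorted-↭)
open import Data.Maybe using (Maybe; just; nothing)
open import Data.Maybe.Relation.Unary.All as Maybe using (just; nothing)
open import Data.Product using (_×_; _,_; ∃; ∃₂; ∃-syntax)
open import Data.Sum using (_⊎_; inj₁; inj₂) renaming (map₂ to ⊎-map₂)
open import Data.Unit using (⊤; tt)
open import Function.Bundles using (_⇔_; mk⇔; Equivalence)
open import Function.Construct.Composition using (_⇔-∘_)
open import Relation.Binary.Definitions using (tri<; tri≈; tri>)
open import Relation.Binary.PropositionalEquality using (_≡_; _≢_; refl; sym; trans; cong; subst; module ≡-Reasoning)
open import Relation.Nullary using (¬_; yes; no; contradiction)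
open import Relation.Nullary.Decidable using (dec-true; dec-false)
open import Relation.Unary using (Pred; Decidable; ∁)

private
  variable
    a b k u x y : ℕ
    R R' S U U' L L' : Row
    mb mc : Maybe ℕ
    v w B : Word
    X : Tableau

-- Counting

count : ∀ {a p} {A : Set a} {P : Pred A p} → Decidable P → List A → ℕ
count P? xs = length (filter P? xs)

#= : Row → ℕ → ℕ
#= R u = count (_≟ u) R

module _ {a p} {A : Set a} {P : Pred A p} (P? : Decidable P) where

  count-accept : ∀ {x} xs → P x → count P? (x ∷ xs) ≡ suc (count P? xs)
  count-accept xs px = cong length (filter-accept P? px)

  count-reject : ∀ {x} xs → ¬ P x → count P? (x ∷ xs) ≡ count P? xs
  count-reject xs ¬px = cong length (filter-reject P? ¬px)

  count≤count-∷ : ∀ x xs → count P? xs ≤ count P? (x ∷ xs)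
  count≤count-∷ x xs with P? x
  ... | yes _ = n≤1+n _
  ... | no _  = ≤-refl

  count-∷-injective : ∀ {x y xs ys} → P x → P y →
                      count P? (x ∷ xs) ≡ count P? (y ∷ ys) → count P? xs ≡ count P? ys
  count-∷-injective {xs = xs} {ys} px py eq =
    suc-injective (trans (sym (count-accept xs px)) (trans eq (count-accept ys py)))

  count-++ : ∀ xs ys → count P? (xs ++ ys) ≡ count P? xs + count P? ys
  count-++ xs ys = trans (cong length (filter-++ P? xs ys)) (length-++ (filter P? xs))

  count-↭ : ∀ {xs ys} → xs ↭ ys → count P? xs ≡ count P? ys
  count-↭ xs↭ys = ↭-length (filter-↭ P? xs↭ys)

  All⇒count≡length : ∀ {xs} → All P xs → count P? xs ≡ length xs
  All⇒count≡length all = cong length (filter-all P? all)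

  count≡length⇒All : ∀ {xs} → count P? xs ≡ length xs → All P xs
  count≡length⇒All {xs} eq = subst (All P) (filter-complete P? eq) (all-filter P? xs)

module _ {a p q} {A : Set a} {P : Pred A p} {Q : Pred A q}
         (P? : Decidable P) (Q? : Decidable Q) (P⇒Q : ∀ {x} → P x → Q x) where

  count-mono : ∀ xs → count P? xs ≤ count Q? xs
  count-mono [] = z≤n
  count-mono (x ∷ xs) with P? x | Q? x
  ... | yes _  | yes _  = s≤s (count-mono xs)
  ... | yes px | no ¬qx = contradiction (P⇒Q px) ¬qx
  ... | no _   | yes _  = m≤n⇒m≤1+n (count-mono xs)
  ... | no _   | no _   = count-mono xs

  count-mono-∈ : ∀ {x xs} → x ∈ xs → ¬ P x → Q x → suc (count P? xs) ≤ count Q? xs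
  count-mono-∈ {x} {_ ∷ xs} (here refl) ¬px qx with P? x | Q? x
  ... | yes px | _      = contradiction px ¬px
  ... | no _   | yes _  = s≤s (count-mono xs)
  ... | no _   | no ¬qx = contradiction qx ¬qx
  count-mono-∈ {_} {y ∷ _} (there x∈xs) ¬px qx with P? y | Q? y
  ... | yes _  | yes _  = s≤s (count-mono-∈ x∈xs ¬px qx)
  ... | yes py | no ¬qy = contradiction (P⇒Q py) ¬qy
  ... | no _   | yes _  = m≤n⇒m≤1+n (count-mono-∈ x∈xs ¬px qx)
  ... | no _   | no _   = count-mono-∈ x∈xs ¬px qx

#≤≡#<+#= : ∀ u R → #≤ R u ≡ #< R u + #= R u
#≤≡#<+#= u [] = refl
#≤≡#<+#= u (r ∷ R) with <-cmp r u
... | tri< r<u r≢u _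
  rewrite count-accept (_≤? u) R (<⇒≤ r<u) | count-accept (_<? u) R r<u | count-reject (_≟ u) R r≢u
  = cong suc (#≤≡#<+#= u R)
... | tri≈ r≮u refl _
  rewrite count-accept (_≤? r) R ≤-refl | count-reject (_<? r) R r≮u | count-accept (_≟ r) R refl
  = trans (cong suc (#≤≡#<+#= r R)) (sym (+-suc _ _))
... | tri> r≮u r≢u u<r
  rewrite count-reject (_≤? u) R (<⇒≱ u<r) | count-reject (_<? u) R r≮u | count-reject (_≟ u) R r≢u
  = #≤≡#<+#= u R

-- Row insertion

Sorted : Row → Set
Sorted = AllPairs _≤_

data RowInsert (x : ℕ) : Row → Row → Maybe ℕ → Set where
  append : RowInsert x [] [ x ] nothing
  bump   : x < y → RowInsert x (y ∷ R) (x ∷ R) (just y)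
  skip   : y ≤ x → RowInsert x R R' mb → RowInsert x (y ∷ R) (y ∷ R') mb

RowInsert-total : ∀ x R → ∃₂ λ R' mb → RowInsert x R R' mb
RowInsert-total x [] = _ , _ , append
RowInsert-total x (y ∷ R) with x <? y | RowInsert-total x R
... | yes x<y | _            = _ , _ , bump x<y
... | no x≮y  | _ , _ , r = _ , _ , skip (≮⇒≥ x≮y) r

RowInsert⇒rowInsert : RowInsert x R R' mb → rowInsert x R ≡ (R' , mb)
RowInsert⇒rowInsert append = refl
RowInsert⇒rowInsert {x} (bump {y} x<y) with x <? y
... | yes _   = refl
... | no x≮y = contradiction x<y x≮y
RowInsert⇒rowInsert {x} (skip {y} y≤x r) with x <? y
... | yes x<y = contradiction x<y (≤⇒≯ y≤x)
... | no _ rewrite RowInsert⇒rowInsert r = refl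

RowInsert-↭ : RowInsert x R R' mb → x ∷ R ↭ fromMaybe mb ++ R'
RowInsert-↭ append   = ↭-refl
RowInsert-↭ (bump _) = ↭-swap _ _ ↭-refl
RowInsert-↭ {x} (skip {y} {R} {R'} {mb} _ r) = begin
  x ∷ y ∷ R             ↭⟨ ↭-swap x y ↭-refl ⟩
  y ∷ x ∷ R             ↭⟨ ↭-prep y (RowInsert-↭ r) ⟩
  y ∷ fromMaybe mb ++ R' ↭⟨ shift y (fromMaybe mb) R' ⟨
  fromMaybe mb ++ y ∷ R' ∎
  where open PermutationReasoning

RowInsert-bumped : RowInsert x R R' mb → Maybe.All (x <_) mb
RowInsert-bumped append     = nothing
RowInsert-bumped (bump x<y) = just x<y
RowInsert-bumped (skip _ r) = RowInsert-bumped r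

RowInsert-bumped-∈ : RowInsert x R R' (just b) → b ∈ R
RowInsert-bumped-∈ (bump _)   = here refl
RowInsert-bumped-∈ (skip _ r) = there (RowInsert-bumped-∈ r)

RowInsert-unbumped : RowInsert x R R' nothing → All (_≤ x) R
RowInsert-unbumped append       = []
RowInsert-unbumped (skip y≤x r) = y≤x ∷ RowInsert-unbumped r

RowInsert-bumped-split : Sorted R → RowInsert x R R' (just b) → All (λ z → z ≤ x ⊎ b ≤ z) R
RowInsert-bumped-split (b≤R ∷ _) (bump _)      = inj₂ ≤-refl ∷ All-map inj₂ b≤R
RowInsert-bumped-split (_ ∷ sR) (skip y≤x r) = inj₁ y≤x ∷ RowInsert-bumped-split sR r

RowInsert-all≤ : All (_≤ x) R → RowInsert x R (R ++ [ x ]) nothing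
RowInsert-all≤ []           = append
RowInsert-all≤ (y≤x ∷ R≤x) = skip y≤x (RowInsert-all≤ R≤x)

RowInsert-length-bump : RowInsert x R R' (just b) → length R' ≡ length R
RowInsert-length-bump (bump _)   = refl
RowInsert-length-bump (skip _ r) = cong suc (RowInsert-length-bump r)

RowInsert-All : ∀ {p} {P : Pred ℕ p} → All P R → P x → RowInsert x R R' mb → All P R'
RowInsert-All []         px append     = px ∷ []
RowInsert-All (_ ∷ pR)  px (bump _)   = px ∷ pR
RowInsert-All (py ∷ pR) px (skip _ r) = py ∷ RowInsert-All pR px r

RowInsert-sorted : Sorted R → RowInsert x R R' mb → Sorted R'
RowInsert-sorted _ append                  = [] ∷ []
RowInsert-sorted (y≤R ∷ sR) (bump x<y)   = All-map (≤-trans (<⇒≤ x<y)) y≤R ∷ sR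
RowInsert-sorted (y≤R ∷ sR) (skip y≤x r) = RowInsert-All y≤R y≤x r ∷ RowInsert-sorted sR r

module _ {p} {P : Pred ℕ p} (P? : Decidable P) where

  RowInsert-count : RowInsert x R R' mb → count P? (x ∷ R) ≡ count P? (fromMaybe mb ++ R')
  RowInsert-count r = count-↭ P? (RowInsert-↭ r)

  RowInsert-count-reject : Maybe.All (∁ P) mb → RowInsert x R R' mb → count P? (x ∷ R) ≡ count P? R'
  RowInsert-count-reject nothing       r = RowInsert-count r
  RowInsert-count-reject (just ¬pb) r = trans (RowInsert-count r) (count-reject P? _ ¬pb)

  RowInsert-count-gain : P x → Maybe.All (∁ P) mb → RowInsert x R R' mb → count P? R' ≡ suc (count P? R)
  RowInsert-count-gain {R = R} px rej r = trans (sym (RowInsert-count-reject rej r)) (count-accept P? R px)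

  RowInsert-count-swap : P x → P b → RowInsert x R R' (just b) → count P? R' ≡ count P? R
  RowInsert-count-swap px pb r = sym (count-∷-injective P? px pb (RowInsert-count r))

  RowInsert-count-mono : (∀ {y z} → y ≤ z → P z → P y) → RowInsert x R R' mb → count P? R ≤ count P? R'
  RowInsert-count-mono down append = z≤n
  RowInsert-count-mono down (bump {y} {R} x<y) with P? y
  ... | yes py = ≤-reflexive (sym (count-accept P? R (down (<⇒≤ x<y) py)))
  ... | no _   = count≤count-∷ P? _ R
  RowInsert-count-mono down (skip {y} _ r) with P? y
  ... | yes _ = s≤s (RowInsert-count-mono down r)
  ... | no _  = RowInsert-count-mono down r

RowInsert-#≤-self : RowInsert x R R' mb → #≤ R' x ≡ suc (#≤ R x)
RowInsert-#≤-self r = RowInsert-count-gain (_≤? _) ≤-refl (Maybe.map <⇒≱ (RowInsert-bumped r)) r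

RowInsert-#≤-mono : RowInsert x R R' mb → #≤ R u ≤ #≤ R' u
RowInsert-#≤-mono = RowInsert-count-mono (_≤? _) ≤-trans

-- Semistandard tableaux

-- The counting form of column strictness: for sorted rows it says that
-- L is no longer than U and strictly exceeds U entrywise.
FitsBelow : Row → Row → Set
FitsBelow L U = ∀ k → #≤ L k ≤ #< U k

Semistandard : Tableau → Set
Semistandard []      = ⊤
Semistandard (R ∷ X) = Sorted R × FitsBelow (rowAt X 0) R × Semistandard X

firstRow-sorted : ∀ X → Semistandard X → Sorted (rowAt X 0)
firstRow-sorted []      _        = []
firstRow-sorted (_ ∷ _) (sR , _) = sR

FitsBelow-∷ : a < b → FitsBelow L U → FitsBelow (b ∷ L) (a ∷ U)
FitsBelow-∷ {a} {b} {L} {U} a<b fit k with b ≤? k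
... | yes b≤k = begin
  count (_≤? k) (b ∷ L) ≡⟨ count-accept (_≤? k) L b≤k ⟩
  suc (#≤ L k)           ≤⟨ s≤s (fit k) ⟩
  suc (#< U k)           ≡⟨ count-accept (_<? k) U (<-≤-trans a<b b≤k) ⟨
  count (_<? k) (a ∷ U) ∎
  where open ≤-Reasoning
... | no b≰k  = begin
  count (_≤? k) (b ∷ L) ≡⟨ count-reject (_≤? k) L b≰k ⟩
  #≤ L k                 ≤⟨ fit k ⟩
  #< U k                 ≤⟨ count≤count-∷ (_<? k) a U ⟩
  count (_<? k) (a ∷ U) ∎
  where open ≤-Reasoning

FitsBelow-insertUpper : RowInsert a U U' mb → FitsBelow L U → FitsBelow L U'
FitsBelow-insertUpper r fit k = ≤-trans (fit k) (RowInsert-count-mono (_<? k) ≤-<-trans r)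

#≤-gap : b ≤ k → All (λ z → z ≤ b ⊎ k < z) L → #≤ L k ≡ #≤ L b
#≤-gap b≤k [] = refl
#≤-gap {b} {k} b≤k (inj₁ z≤b ∷ gap) =
  trans (count-accept (_≤? k) _ (≤-trans z≤b b≤k))
        (trans (cong suc (#≤-gap b≤k gap)) (sym (count-accept (_≤? b) _ z≤b)))
#≤-gap {b} {k} b≤k (inj₂ k<z ∷ gap) =
  trans (count-reject (_≤? k) _ (<⇒≱ k<z))
        (trans (#≤-gap b≤k gap) (sym (count-reject (_≤? b) _ (<⇒≱ (≤-<-trans b≤k k<z)))))

FitsBelow-insert : Sorted L → RowInsert a U U' (just b) → RowInsert b L L' mc →
                   FitsBelow L U → FitsBelow L' U'
FitsBelow-insert {L} {a} {U} {U'} {b} {L'} sL ra rb fit k with b <? k | RowInsert-bumped ra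
... | no b≮k | just a<b = begin
  #≤ L' k                ≡⟨ RowInsert-count-reject (_≤? k) c≰k rb ⟨
  count (_≤? k) (b ∷ L) ≤⟨ FitsBelow-∷ a<b fit k ⟩
  count (_<? k) (a ∷ U) ≡⟨ RowInsert-count (_<? k) ra ⟩
  count (_<? k) (b ∷ U') ≡⟨ count-reject (_<? k) U' b≮k ⟩
  #< U' k                ∎
  where
  open ≤-Reasoning
  c≰k : Maybe.All (_≰ k) _
  c≰k = Maybe.map (λ b<c c≤k → b≮k (<-≤-trans b<c c≤k)) (RowInsert-bumped rb)
... | yes b<k | just a<b = ≤-trans (lower rb) (≤-reflexive upper)
  where
  upper : #< U k ≡ #< U' k
  upper = count-∷-injective (_<? k) (<-trans a<b b<k) b<k (RowInsert-count (_<? k) ra)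

  viaGap : RowInsert b L L' mc → All (λ z → z ≤ b ⊎ k < z) L → Maybe.All (_≰ k) mc → #≤ L' k ≤ #< U k
  viaGap rb gap rej = begin
    #≤ L' k        ≡⟨ RowInsert-count-gain (_≤? k) (<⇒≤ b<k) rej rb ⟩
    suc (#≤ L k)   ≡⟨ cong suc (#≤-gap (<⇒≤ b<k) gap) ⟩
    suc (#≤ L b)   ≤⟨ s≤s (fit b) ⟩
    suc (#< U b)   ≤⟨ count-mono-∈ (_<? b) (_<? k) (λ z<b → <-trans z<b b<k)
                                     (RowInsert-bumped-∈ ra) (<-irrefl refl) b<k ⟩
    #< U k         ∎
    where open ≤-Reasoning

  lower : RowInsert b L L' mc → #≤ L' k ≤ #< U k
  lower {nothing} rb = viaGap rb (All-map inj₁ (RowInsert-unbumped rb)) nothing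
  lower {just c}  rb with c ≤? k
  ... | yes c≤k = ≤-trans (≤-reflexive (RowInsert-count-swap (_≤? k) (<⇒≤ b<k) c≤k rb)) (fit k)
  ... | no c≰k  =
    viaGap rb (All-map (⊎-map₂ (<-≤-trans (≰⇒> c≰k))) (RowInsert-bumped-split sL rb)) (just c≰k)

insertWord : Word → Tableau → Tableau
insertWord w T = foldl (λ T x → insert x T) T w

insert-∷ : RowInsert x R R' mb → insert x (R ∷ X) ≡ R' ∷ insertWord (fromMaybe mb) X
insert-∷ {mb = nothing} r rewrite RowInsert⇒rowInsert r = refl
insert-∷ {mb = just _}  r rewrite RowInsert⇒rowInsert r = refl

insert-firstRow : ∀ b X → ∃ (RowInsert b (rowAt X 0) (rowAt (insert b X) 0))
insert-firstRow b []      = nothing , append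
insert-firstRow b (L ∷ Y) with RowInsert-total b L
... | _ , mc , rb rewrite insert-∷ {X = Y} rb = mc , rb

insert-semistandard : ∀ x X → Semistandard X → Semistandard (insert x X)
insert-semistandard x [] _ = [] ∷ [] , (λ _ → z≤n) , tt
insert-semistandard x (R ∷ X) (sR , fit , sX) with RowInsert-total x R
... | _ , nothing , r rewrite insert-∷ {X = X} r =
  RowInsert-sorted sR r , FitsBelow-insertUpper {L = rowAt X 0} r fit , sX
... | _ , just b , r rewrite insert-∷ {X = X} r with insert-firstRow b X
... | _ , rb = RowInsert-sorted sR r , FitsBelow-insert (firstRow-sorted X sX) r rb fit , insert-semistandard b X sX

insertWord-semistandard : ∀ w X → Semistandard X → Semistandard (insertWord w X)
insertWord-semistandard []      X sX = sX
insertWord-semistandard (x ∷ w) X sX = insertWord-semistandard w (insert x X) (insert-semistandard x X sX)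

P-semistandard : ∀ w → Semistandard (P w)
P-semistandard w = insertWord-semistandard w [] tt

insert-↭ : ∀ x X → concat (insert x X) ↭ x ∷ concat X
insert-↭ x [] = ↭-refl
insert-↭ x (R ∷ X) with RowInsert-total x R
... | R' , nothing , r rewrite insert-∷ {X = X} r = ++⁺ʳ (concat X) (↭-sym (RowInsert-↭ r))
... | R' , just b , r rewrite insert-∷ {X = X} r = begin
  R' ++ concat (insert b X) ↭⟨ ++⁺ˡ R' (insert-↭ b X) ⟩
  R' ++ b ∷ concat X        ↭⟨ shift b R' (concat X) ⟩
  b ∷ R' ++ concat X        ↭⟨ ++⁺ʳ (concat X) (RowInsert-↭ r) ⟨
  x ∷ R ++ concat X         ∎
  where open PermutationReasoning

insertWord-↭ : ∀ w X → concat (insertWord w X) ↭ concat X ++ w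
insertWord-↭ [] X = ↭-reflexive (sym (++-identityʳ (concat X)))
insertWord-↭ (x ∷ w) X = begin
  concat (insertWord w (insert x X)) ↭⟨ insertWord-↭ w (insert x X) ⟩
  concat (insert x X) ++ w           ↭⟨ ++⁺ʳ w (insert-↭ x X) ⟩
  x ∷ concat X ++ w                  ↭⟨ shift x (concat X) w ⟨
  concat X ++ x ∷ w                  ∎
  where open PermutationReasoning

#=-P : ∀ u w → #= (concat (P w)) u ≡ #= w u
#=-P u w = count-↭ (_≟ u) (insertWord-↭ w [])

-- The first-row criterion

TightAt : ℕ → Tableau → Set
TightAt u X = ∀ i → #< (rowAt X i) u ≡ #≤ (rowAt X (suc i)) u

#=-concat-≤ : ∀ u X → Semistandard X → #= (concat X) u ≤ #≤ (rowAt X 0) u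
#=-concat-≤ u [] _ = z≤n
#=-concat-≤ u (U ∷ X) (_ , fit , sX) = begin
  #= (U ++ concat X) u       ≡⟨ count-++ (_≟ u) U (concat X) ⟩
  #= U u + #= (concat X) u   ≤⟨ +-monoʳ-≤ (#= U u) (≤-trans (#=-concat-≤ u X sX) (fit u)) ⟩
  #= U u + #< U u            ≡⟨ +-comm (#= U u) _ ⟩
  #< U u + #= U u            ≡⟨ #≤≡#<+#= u U ⟨
  #≤ U u                     ∎
  where open ≤-Reasoning

#=-concat≡⇔TightAt : ∀ u X → Semistandard X → (#= (concat X) u ≡ #≤ (rowAt X 0) u) ⇔ TightAt u X
#=-concat≡⇔TightAt u [] _ = mk⇔ (λ _ _ → refl) (λ _ → refl)
#=-concat≡⇔TightAt u (U ∷ X) (_ , fit , sX) = mk⇔ to from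
  where
  rest : (#= (concat X) u ≡ #≤ (rowAt X 0) u) ⇔ TightAt u X
  rest = #=-concat≡⇔TightAt u X sX
  split : #= (concat (U ∷ X)) u ≡ #= U u + #= (concat X) u
  split = count-++ (_≟ u) U (concat X)
  #≤U : #≤ U u ≡ #= U u + #< U u
  #≤U = trans (#≤≡#<+#= u U) (+-comm _ (#= U u))

  rest≡#<U : #= (concat (U ∷ X)) u ≡ #≤ U u → #= (concat X) u ≡ #< U u
  rest≡#<U eq = +-cancelˡ-≡ (#= U u) _ _ (trans (sym split) (trans eq #≤U))

  rest≡#≤head : #= (concat (U ∷ X)) u ≡ #≤ U u → #= (concat X) u ≡ #≤ (rowAt X 0) u
  rest≡#≤head eq = ≤-antisym (#=-concat-≤ u X sX) (≤-trans (fit u) (≤-reflexive (sym (rest≡#<U eq))))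

  to : #= (concat (U ∷ X)) u ≡ #≤ U u → TightAt u (U ∷ X)
  to eq zero    = trans (sym (rest≡#<U eq)) (rest≡#≤head eq)
  to eq (suc i) = Equivalence.to rest (rest≡#≤head eq) i

  from : TightAt u (U ∷ X) → #= (concat (U ∷ X)) u ≡ #≤ U u
  from tight = begin
    #= (concat (U ∷ X)) u     ≡⟨ split ⟩
    #= U u + #= (concat X) u  ≡⟨ cong (#= U u +_) (Equivalence.from rest (λ i → tight (suc i))) ⟩
    #= U u + #≤ (rowAt X 0) u ≡⟨ cong (#= U u +_) (tight 0) ⟨
    #= U u + #< U u           ≡⟨ #≤U ⟨
    #≤ U u                    ∎
    where open ≡-Reasoning

firstRow-criterion : ∀ u X → Semistandard X →
  (#= (concat X) u ≡ length (rowAt X 0)) ⇔ (All (_≤ u) (rowAt X 0) × TightAt u X)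
firstRow-criterion u X sX = mk⇔ to from
  where
  R₁ : Row
  R₁ = rowAt X 0
  tightness : (#= (concat X) u ≡ #≤ R₁ u) ⇔ TightAt u X
  tightness = #=-concat≡⇔TightAt u X sX

  to : #= (concat X) u ≡ length R₁ → All (_≤ u) R₁ × TightAt u X
  to eq = count≡length⇒All (_≤? u) #≤≡length , Equivalence.to tightness #=≡#≤
    where
    #≤≡length : #≤ R₁ u ≡ length R₁
    #≤≡length = ≤-antisym (length-filter (_≤? u) R₁) (≤-trans (≤-reflexive (sym eq)) (#=-concat-≤ u X sX))
    #=≡#≤ : #= (concat X) u ≡ #≤ R₁ u
    #=≡#≤ = trans eq (sym #≤≡length)

  from : All (_≤ u) R₁ × TightAt u X → #= (concat X) u ≡ length R₁
  from (R₁≤u , t) = trans (Equivalence.from tightness t) (All⇒count≡length (_≤? u) R₁≤u)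

-- Commuting u with w

data RowInsertWord : Word → Row → Row → Word → Set where
  []  : ∀ {R} → RowInsertWord [] R R []
  _∷_ : ∀ {x v R R' R'' mb B} → RowInsert x R R' mb → RowInsertWord v R' R'' B →
        RowInsertWord (x ∷ v) R R'' (fromMaybe mb ++ B)

RowInsertWord-total : ∀ v R → ∃₂ λ R' B → RowInsertWord v R R' B
RowInsertWord-total []      R = _ , _ , []
RowInsertWord-total (x ∷ v) R with RowInsert-total x R
... | R' , _ , r with RowInsertWord-total v R'
... | _ , _ , run = _ , _ , r ∷ run

RowInsertWord-sorted : Sorted R → RowInsertWord v R R' B → Sorted R'
RowInsertWord-sorted sR []        = sR
RowInsertWord-sorted sR (r ∷ run) = RowInsertWord-sorted (RowInsert-sorted sR r) run

insertWord-∷ : RowInsertWord v R R' B → insertWord v (R ∷ X) ≡ R' ∷ insertWord B X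
insertWord-∷ [] = refl
insertWord-∷ {X = X} (_∷_ {x} {v} {R} {R'} {R''} {mb} {B} r run) = begin
  insertWord v (insert x (R ∷ X))                ≡⟨ cong (insertWord v) (insert-∷ r) ⟩
  insertWord v (R' ∷ insertWord (fromMaybe mb) X) ≡⟨ insertWord-∷ run ⟩
  R'' ∷ insertWord B (insertWord (fromMaybe mb) X) ≡⟨ cong (R'' ∷_) (foldl-++ _ X (fromMaybe mb) B) ⟨
  R'' ∷ insertWord (fromMaybe mb ++ B) X          ∎
  where open ≡-Reasoning

insertSorted-head : All (y ≤_) R → insertSorted y R ≡ y ∷ R
insertSorted-head []          = refl
insertSorted-head (y≤r ∷ _) rewrite dec-true (_ ≤? _) y≤r = refl

-- insertSorted puts y in front of entries equal to y, so the trailing run of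
-- y's in R has to be recognised as constant.
insertSorted-all≤ : Sorted R → All (_≤ y) R → insertSorted y R ≡ R ++ [ y ]
insertSorted-all≤ [] [] = refl
insertSorted-all≤ {r ∷ R} {y} (r≤R ∷ sR) (r≤y ∷ R≤y) with y ≤? r
... | no y≰r rewrite dec-false (y ≤? r) y≰r = cong (r ∷_) (insertSorted-all≤ sR R≤y)
... | yes y≤r rewrite dec-true (y ≤? r) y≤r with ≤-antisym r≤y y≤r
... | refl = cong (r ∷_) (constant (All.zipWith (λ (z≤r , r≤z) → ≤-antisym z≤r r≤z) (R≤y , r≤R)))
  where
  constant : ∀ {R} → All (_≡ r) R → r ∷ R ≡ R ++ [ r ]
  constant []           = refl
  constant (refl ∷ R≡r) = cong (r ∷_) (constant R≡r)

RowInsert-insertSorted-≤ : y ≤ x → RowInsert x R R' mb → RowInsert x (insertSorted y R) (insertSorted y R') mb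
RowInsert-insertSorted-≤ {y} {x} y≤x append rewrite dec-true (y ≤? x) y≤x = skip y≤x append
RowInsert-insertSorted-≤ {y} {x} y≤x (bump {r} x<r)
  rewrite dec-true (y ≤? r) (≤-trans y≤x (<⇒≤ x<r)) | dec-true (y ≤? x) y≤x = skip y≤x (bump x<r)
RowInsert-insertSorted-≤ {y} y≤x (skip {r} r≤x r') with y ≤? r
... | yes y≤r rewrite dec-true (y ≤? r) y≤r = skip y≤x (skip r≤x r')
... | no y≰r rewrite dec-false (y ≤? r) y≰r = skip r≤x (RowInsert-insertSorted-≤ y≤x r')

RowInsert-insertSorted-≥bumped : Sorted R → x < y → b ≤ y → RowInsert x R R' (just b) →
                                 RowInsert x (insertSorted y R) (insertSorted y R') (just b)
RowInsert-insertSorted-≥bumped {y = y} (b≤R ∷ _) x<y b≤y (bump {b} x<b)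
  rewrite dec-false (y ≤? _) (<⇒≱ x<y) with y ≤? b
... | no y≰b rewrite dec-false (y ≤? b) y≰b = bump x<b
... | yes y≤b rewrite dec-true (y ≤? b) y≤b with ≤-antisym y≤b b≤y
... | refl rewrite insertSorted-head b≤R = bump x<b
RowInsert-insertSorted-≥bumped {y = y} (_ ∷ sR) x<y b≤y (skip {r} r≤x r')
  rewrite dec-false (y ≤? r) (<⇒≱ (≤-<-trans r≤x x<y)) = skip r≤x (RowInsert-insertSorted-≥bumped sR x<y b≤y r')

RowInsert-insertSorted-<bumped : Sorted R → x < y → y < b → RowInsert x R R' (just b) →
                                 RowInsert x (insertSorted y R) (insertSorted b R') (just y)
RowInsert-insertSorted-<bumped {y = y} (b≤R ∷ _) x<y y<b (bump {b} x<b)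
  rewrite dec-true (y ≤? b) (<⇒≤ y<b) | dec-false (b ≤? _) (<⇒≱ x<b) | insertSorted-head b≤R = bump x<y
RowInsert-insertSorted-<bumped {y = y} {b = b} (_ ∷ sR) x<y y<b (skip {r} r≤x r')
  rewrite dec-false (y ≤? r) (<⇒≱ (≤-<-trans r≤x x<y))
        | dec-false (b ≤? r) (<⇒≱ (≤-<-trans r≤x (<-trans x<y y<b)))
  = skip r≤x (RowInsert-insertSorted-<bumped sR x<y y<b r')

RowInsert-insertSorted-unbumped : x < y → RowInsert x R R' nothing → RowInsert x (insertSorted y R) R' (just y)
RowInsert-insertSorted-unbumped x<y append = bump x<y
RowInsert-insertSorted-unbumped {y = y} x<y (skip {r} r≤x r')
  rewrite dec-false (y ≤? r) (<⇒≱ (≤-<-trans r≤x x<y)) = skip r≤x (RowInsert-insertSorted-unbumped x<y r')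

ExtendsAbove : ℕ → Row → Row → Set
ExtendsAbove u S R = S ≡ R ⊎ ∃[ y ] u < y × S ≡ insertSorted y R

ExtendsAbove-#≤ : ExtendsAbove u S R → #≤ S u ≡ #≤ R u
ExtendsAbove-#≤ (inj₁ refl) = refl
ExtendsAbove-#≤ {u} {R = R} (inj₂ (y , u<y , refl)) =
  trans (count-↭ (_≤? u) (insertSorted-↭ y R)) (count-reject (_≤? u) R (<⇒≱ u<y))

RowInsert-ExtendsAbove : Sorted R → RowInsert x R R' mb → ExtendsAbove u S R →
                         ∃₂ λ S' mb' → RowInsert x S S' mb' × ExtendsAbove u S' R'
RowInsert-ExtendsAbove _ r (inj₁ refl) = _ , _ , r , inj₁ refl
RowInsert-ExtendsAbove {R = R} {x = x} {u = u} sR r (inj₂ (y , u<y , refl)) with y ≤? x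
... | yes y≤x = _ , _ , RowInsert-insertSorted-≤ y≤x r , inj₂ (y , u<y , refl)
... | no y≰x = insertingSmaller r
  where
  x<y : x < y
  x<y = ≰⇒> y≰x
  insertingSmaller : RowInsert x R R' mb → ∃₂ λ S' mb' → RowInsert x (insertSorted y R) S' mb' × ExtendsAbove u S' R'
  insertingSmaller {mb = nothing} r = _ , _ , RowInsert-insertSorted-unbumped x<y r , inj₁ refl
  insertingSmaller {mb = just b}  r with b ≤? y
  ... | yes b≤y = _ , _ , RowInsert-insertSorted-≥bumped sR x<y b≤y r , inj₂ (y , u<y , refl)
  ... | no b≰y  = _ , _ , RowInsert-insertSorted-<bumped sR x<y y<b r , inj₂ (_ , <-trans u<y y<b , refl)
    where
    y<b : y < b
    y<b = ≰⇒> b≰y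

RowInsertWord-ExtendsAbove : Sorted R → RowInsertWord v R R' B → ExtendsAbove u S R →
                             ∃₂ λ S' B' → RowInsertWord v S S' B' × ExtendsAbove u S' R'
RowInsertWord-ExtendsAbove _ [] ext = _ , _ , [] , ext
RowInsertWord-ExtendsAbove sR (r ∷ run) ext with RowInsert-ExtendsAbove sR r ext
... | _ , _ , r' , ext' with RowInsertWord-ExtendsAbove (RowInsert-sorted sR r) run ext'
... | _ , _ , run' , ext'' = _ , _ , r' ∷ run' , ext''

+-#=-self : ∀ n x → n + #= [ x ] x ≡ suc n
+-#=-self n x = trans (cong (n +_) (count-accept (_≟ x) [] refl)) (+-comm n 1)

+-#=-other : ∀ n → x ≢ u → n + #= [ x ] u ≡ n
+-#=-other {u = u} n x≢u = trans (cong (n +_) (count-reject (_≟ u) [] x≢u)) (+-identityʳ n)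

RowInsert-#≤ : RowInsert x R R' mb → #≤ R u + #= [ x ] u ≤ #≤ R' u
RowInsert-#≤ {x} {R} {u = u} r with x ≟ u
... | yes refl = ≤-reflexive (trans (+-#=-self (#≤ R x) x) (sym (RowInsert-#≤-self r)))
... | no x≢u   = ≤-trans (≤-reflexive (+-#=-other (#≤ R u) x≢u)) (RowInsert-#≤-mono r)

+-#=-∷ : ∀ n x v u → n + #= (x ∷ v) u ≡ n + #= [ x ] u + #= v u
+-#=-∷ n x v u = trans (cong (n +_) (count-++ (_≟ u) [ x ] v)) (sym (+-assoc n _ _))

RowInsertWord-#≤ : RowInsertWord v R R' B → #≤ R u + #= v u ≤ #≤ R' u
RowInsertWord-#≤ {u = u} [] = ≤-reflexive (+-identityʳ _)
RowInsertWord-#≤ {u = u} (_∷_ {x} {v} {R} {R'} {R''} r run) = begin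
  #≤ R u + #= (x ∷ v) u        ≡⟨ +-#=-∷ (#≤ R u) x v u ⟩
  #≤ R u + #= [ x ] u + #= v u ≤⟨ +-monoˡ-≤ (#= v u) (RowInsert-#≤ r) ⟩
  #≤ R' u + #= v u             ≤⟨ RowInsertWord-#≤ run ⟩
  #≤ R'' u                     ∎
  where open ≤-Reasoning

data RowInsertWithExtra (u x : ℕ) (R R' : Row) (mb : Maybe ℕ) : Set where
  together : RowInsert x (insertSorted u R) (insertSorted u R') mb →
             #≤ R u + #= [ x ] u ≡ #≤ R' u → RowInsertWithExtra u x R R' mb
  apart    : ∀ {S' mb'} → RowInsert x (insertSorted u R) S' mb' → ExtendsAbove u S' R' →
             #≤ R u + #= [ x ] u < #≤ R' u → RowInsertWithExtra u x R R' mb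

RowInsert-withExtra : Sorted R → RowInsert x R R' mb → RowInsertWithExtra u x R R' mb
RowInsert-withExtra {R = R} {x = x} {R' = R'} {u = u} sR r with <-cmp x u
... | tri≈ _ refl _ = together (RowInsert-insertSorted-≤ ≤-refl r) gained
  where
  gained : #≤ R x + #= [ x ] x ≡ #≤ R' x
  gained = trans (+-#=-self (#≤ R x) x) (sym (RowInsert-#≤-self r))
... | tri> _ x≢u u<x = together (RowInsert-insertSorted-≤ (<⇒≤ u<x) r) unchanged
  where
  bumped≰u : Maybe.All (_≰ u) _
  bumped≰u = Maybe.map (λ x<b → <⇒≱ (<-trans u<x x<b)) (RowInsert-bumped r)
  unchanged : #≤ R u + #= [ x ] u ≡ #≤ R' u
  unchanged = trans (+-#=-other (#≤ R u) x≢u)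
                (trans (sym (count-reject (_≤? u) R (<⇒≱ u<x))) (RowInsert-count-reject (_≤? u) bumped≰u r))
... | tri< x<u x≢u _ = insertingSmaller r
  where
  x-uncounted : #≤ R u + #= [ x ] u ≡ #≤ R u
  x-uncounted = +-#=-other (#≤ R u) x≢u

  gain : Maybe.All (_≰ u) mb → RowInsert x R R' mb → #≤ R u + #= [ x ] u < #≤ R' u
  gain rej r = ≤-reflexive (trans (cong suc x-uncounted) (sym (RowInsert-count-gain (_≤? u) (<⇒≤ x<u) rej r)))

  insertingSmaller : RowInsert x R R' mb → RowInsertWithExtra u x R R' mb
  insertingSmaller {mb = nothing} r = apart (RowInsert-insertSorted-unbumped x<u r) (inj₁ refl) (gain nothing r)
  insertingSmaller {mb = just b}  r with b ≤? u
  ... | yes b≤u = together (RowInsert-insertSorted-≥bumped sR x<u b≤u r)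
                           (trans x-uncounted (sym (RowInsert-count-swap (_≤? u) (<⇒≤ x<u) b≤u r)))
  ... | no b≰u  = apart (RowInsert-insertSorted-<bumped sR x<u (≰⇒> b≰u) r)
                        (inj₂ (b , ≰⇒> b≰u , refl)) (gain (just b≰u) r)

data RowInsertWordWithExtra (u : ℕ) (v : Word) (R R' : Row) (B : Word) : Set where
  together : RowInsertWord v (insertSorted u R) (insertSorted u R') B →
             #≤ R u + #= v u ≡ #≤ R' u → RowInsertWordWithExtra u v R R' B
  apart    : ∀ {S' B'} → RowInsertWord v (insertSorted u R) S' B' → #≤ S' u ≡ #≤ R' u →
             #≤ R u + #= v u < #≤ R' u → RowInsertWordWithExtra u v R R' B

RowInsertWord-withExtra : Sorted R → RowInsertWord v R R' B → RowInsertWordWithExtra u v R R' B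
RowInsertWord-withExtra _ [] = together [] (+-identityʳ _)
RowInsertWord-withExtra {u = u} sR (_∷_ {x} {v} {R} r run)
  with RowInsert-withExtra {u = u} sR r | RowInsertWord-withExtra {u = u} (RowInsert-sorted sR r) run
... | together r' eq | together run' eq' =
  together (r' ∷ run') (trans (+-#=-∷ (#≤ R u) x v u) (trans (cong (_+ #= v u) eq) eq'))
... | together r' eq | apart run' same lt =
  apart (r' ∷ run') same
        (≤-trans (s≤s (≤-reflexive (trans (+-#=-∷ (#≤ R u) x v u) (cong (_+ #= v u) eq)))) lt)
... | apart r' ext lt | _ with RowInsertWord-ExtendsAbove (RowInsert-sorted sR r) run ext
... | _ , _ , run' , ext' =
  apart (r' ∷ run') (ExtendsAbove-#≤ ext')
        (≤-trans (s≤s (≤-reflexive (+-#=-∷ (#≤ R u) x v u))) (≤-trans (+-monoˡ-≤ (#= v u) lt) (RowInsertWord-#≤ run)))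

P-∷ʳ : ∀ w x → P (w ++ [ x ]) ≡ insert x (P w)
P-∷ʳ w x = foldl-++ _ [] w [ x ]

commute-criterion : RowInsertWord w [] R B →
  (insertWord w [ [ u ] ] ≡ insert u (R ∷ insertWord B [])) ⇔ (#= w u ≡ length R)
commute-criterion {w} {R} {B} {u} run with RowInsertWord-withExtra {u = u} [] run | RowInsert-total u R
... | together run' #=≡#≤ | R' , _ , r = mk⇔ to from
  where
  Y : Tableau
  Y = insertWord B []

  unbumped : RowInsert u R R' mb → insertSorted u R ≡ R' → All (_≤ u) R
  unbumped {mb = nothing} r _  = RowInsert-unbumped r
  unbumped {mb = just _}  r eq = contradiction
    (trans (sym (↭-length (insertSorted-↭ u R))) (trans (cong length eq) (RowInsert-length-bump r))) 1+n≢n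

  to : insertWord w [ [ u ] ] ≡ insert u (R ∷ Y) → #= w u ≡ length R
  to eq = trans #=≡#≤ (All⇒count≡length (_≤? u) (unbumped r firstRows))
    where
    firstRows : insertSorted u R ≡ R'
    firstRows = ∷-injectiveˡ (trans (sym (insertWord-∷ run')) (trans eq (insert-∷ r)))

  from : #= w u ≡ length R → insertWord w [ [ u ] ] ≡ insert u (R ∷ Y)
  from eq = begin
    insertWord w [ [ u ] ] ≡⟨ insertWord-∷ run' ⟩
    insertSorted u R ∷ Y   ≡⟨ cong (_∷ Y) (insertSorted-all≤ (RowInsertWord-sorted [] run) R≤u) ⟩
    (R ++ [ u ]) ∷ Y       ≡⟨ insert-∷ (RowInsert-all≤ R≤u) ⟨
    insert u (R ∷ Y)       ∎
    where
    open ≡-Reasoning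
    R≤u : All (_≤ u) R
    R≤u = count≡length⇒All (_≤? u) (trans (sym #=≡#≤) eq)
... | apart {S} run' #≤S≡#≤R #=<#≤ | R' , _ , r = mk⇔ to from
  where
  to : insertWord w [ [ u ] ] ≡ insert u (R ∷ insertWord B []) → #= w u ≡ length R
  to eq = contradiction (trans (sym (RowInsert-#≤-self r)) (trans (cong (λ T → #≤ T u) (sym firstRows)) #≤S≡#≤R)) 1+n≢n
    where
    firstRows : S ≡ R'
    firstRows = ∷-injectiveˡ (trans (sym (insertWord-∷ run')) (trans eq (insert-∷ r)))

  from : #= w u ≡ length R → insertWord w [ [ u ] ] ≡ insert u (R ∷ insertWord B [])
  from eq = contradiction (≤-trans #=<#≤ (≤-trans (length-filter (_≤? u) R) (≤-reflexive (sym eq)))) (<-irrefl refl)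

commute⇔#=≡length : ∀ u w → ((u ∷ w) ≡K (w ++ [ u ])) ⇔ (#= w u ≡ length (rowAt (P w) 0))
commute⇔#=≡length u [] = mk⇔ (λ _ → refl) (λ _ → refl)
commute⇔#=≡length u w@(_ ∷ _) with RowInsertWord-total w []
... | R , B , run rewrite P-∷ʳ w u | insertWord-∷ {X = []} run = commute-criterion run

theorem3p1 : (u : ℕ) → 0 < u → (w : Word) → All (0 <_) w →
    ((u ∷ w) ≡K (w ++ [ u ]))
      ⇔ (All (_≤ u) (rowAt (P w) 0)
         × ((i : ℕ) → #< (rowAt (P w) i) u ≡ #≤ (rowAt (P w) (suc i)) u))
theorem3p1 u _ w _ =
  firstRow-criterion u (P w) (P-semistandard w) ⇔-∘ (content ⇔-∘ commute⇔#=≡length u w)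
  where
  content : (#= w u ≡ length (rowAt (P w) 0)) ⇔ (#= (concat (P w)) u ≡ length (rowAt (P w) 0))
  content = mk⇔ (trans (#=-P u w)) (trans (sym (#=-P u w)))
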